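{- Let $T$ be a $\Delta(1,2,2)$-free tournament with $n$ vertices and let $\sigma=(v_1,\dots,v_n)$ be an ordering of $T$. Suppose there is $i\in[n]$ such that every vertex of $T$ other than $v_i$ is paved in $B_\sigma(T)$ and $v_i$ is nearly paved in $B_\sigma(T)$. Then $T$ is a paving tournament.
   Context: Tournaments are finite; $X\Rightarrow Y$ means all edges between disjoint $X,Y$ go from $X$ to $Y$. $\Delta(1,2,2)$: vertices $x,y_1,y_2,z_1,z_2$ with $x\Rightarrow\{y_1,y_2\}\Rightarrow\{z_1,z_2\}\Rightarrow x$ and edges $y_1y_2,z_1z_2$; $T$ is $\Delta(1,2,2)$-free if no induced subtournament is isomorphic to it. For an ordering $\sigma=(v_1,\dots,v_n)$ of $V(T)$, the backedge graph $B_\sigma(T)$ is the undirected graph on $V(T)$ with edges $v_iv_j$ for $i>j$ with $v_iv_j\in E(T)$ (directed from $v_i$ to $v_j$). A $B_\sigma(T)$-neighbour $v_j$ of $v_i$ is a left-neighbour if $j<i$ and a right-neighbour if $j>i$. A vertex is paved in $B_\sigma(T)$ if it has at most one left-neighbour and at most one right-neighbour; it is nearly paved if it has exactly two left-neighbours and at most one right-neighbour, or at most one left-neighbour and exactly two right-neighbours. $T$ is a paving tournament if there is an ordering $\sigma=(v_1,\dots,v_n)$ such that $v_i,v_{i+1}$ are nonadjacent in $B_\sigma(T)$ for all $i\in[n-1]$ and every vertex is paved in $B_\sigma(T)$. -}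

module Defs where

open import Data.Nat using (ℕ; suc)
open import Data.Fin using (Fin; toℕ; _<_; inject₁; suc)
open import Data.Product using (Σ; _×_; _,_; ∃)
open import Data.Sum using (_⊎_)
open import Data.Empty using (⊥)
open import Relation.Nullary using (¬_; Dec)
open import Relation.Binary.PropositionalEquality using (_≡_; _≢_)
open import Function.Bundles using (_↔_; Inverse)
open import Level using (0ℓ)

record Tournament (n : ℕ) : Set₁ where
  field
    _⇒_      : Fin n → Fin n → Set
    ⇒-dec    : ∀ u v → Dec (u ⇒ v)
    irrefl   : ∀ u → ¬ (u ⇒ u)
    asym     : ∀ u v → u ⇒ v → ¬ (v ⇒ u)
    total    : ∀ u v → u ≢ v → (u ⇒ v) ⊎ (v ⇒ u)

open Tournament public

-- T contains Δ(1,2,2) as an induced subtournament: five distinct vertices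
-- x, y₁, y₂, z₁, z₂ with x ⇒ {y₁,y₂} ⇒ {z₁,z₂} ⇒ x.  (The edges y₁y₂ and
-- z₁z₂ exist automatically in a tournament; by symmetry of the labels their
-- direction is irrelevant for isomorphism.)
record Δ122 {n : ℕ} (T : Tournament n) : Set where
  field
    x y₁ y₂ z₁ z₂ : Fin n
    y₁≢y₂ : y₁ ≢ y₂
    z₁≢z₂ : z₁ ≢ z₂
    x⇒y₁ : _⇒_ T x y₁
    x⇒y₂ : _⇒_ T x y₂
    y₁⇒z₁ : _⇒_ T y₁ z₁
    y₁⇒z₂ : _⇒_ T y₁ z₂
    y₂⇒z₁ : _⇒_ T y₂ z₁
    y₂⇒z₂ : _⇒_ T y₂ z₂
    z₁⇒x : _⇒_ T z₁ x
    z₂⇒x : _⇒_ T z₂ x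

Δ122-free : {n : ℕ} → Tournament n → Set
Δ122-free T = ¬ Δ122 T

-- An ordering σ = (v₁,…,vₙ) of V(T): a bijection from positions to vertices.
Ordering : ℕ → Set
Ordering n = Fin n ↔ Fin n

module _ {n : ℕ} (T : Tournament n) (σ : Ordering n) where
  private
    v : Fin n → Fin n
    v = Inverse.to σ

  -- positions i, j adjacent in B_σ(T): the later one has an edge to the earlier.
  Back : Fin n → Fin n → Set
  Back i j = (j < i × _⇒_ T (v i) (v j)) ⊎ (i < j × _⇒_ T (v j) (v i))

  LeftNbr : Fin n → Fin n → Set
  LeftNbr i j = j < i × Back i j

  RightNbr : Fin n → Fin n → Set
  RightNbr i j = i < j × Back i j

  AtMostOne : (Fin n → Set) → Set
  AtMostOne P = ∀ j k → P j → P k → j ≡ k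

  ExactlyTwo : (Fin n → Set) → Set
  ExactlyTwo P = Σ (Fin n) λ j → Σ (Fin n) λ k →
    j ≢ k × P j × P k × (∀ l → P l → (l ≡ j) ⊎ (l ≡ k))

  Paved : Fin n → Set
  Paved i = AtMostOne (LeftNbr i) × AtMostOne (RightNbr i)

  NearlyPaved : Fin n → Set
  NearlyPaved i = (ExactlyTwo (LeftNbr i) × AtMostOne (RightNbr i))
                ⊎ (AtMostOne (LeftNbr i) × ExactlyTwo (RightNbr i))

  ConsecutiveNonadjacent : Set
  ConsecutiveNonadjacent =
    ∀ (i : Fin n) (p : suc (toℕ i) Data.Nat.< n) →
      ¬ Back i (Data.Fin.fromℕ< p)

Paving : {n : ℕ} → Tournament n → Set
Paving {n} T = Σ (Ordering n) λ σ →
  ConsecutiveNonadjacent T σ × (∀ i → Paved T σ i)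

{-# OPTIONS --safe #-}
-- Let c be the nearly paved vertex.  Passing to the converse tournament with the reversed
-- ordering exchanges left- and right-neighbours, so we may assume that c has exactly two
-- left-neighbours a, b (a before b) and at most one right-neighbour.  A vertex after b that
-- points to c is beaten by both a and b, whose unique right-neighbour is c; two such vertices
-- would span a Δ(1,2,2) with c, a, b.  Hence at most one vertex w lies strictly between b and
-- c, and if it exists then c has no right-neighbour.  If w has no left-neighbour we swap w and
-- c; otherwise Δ(1,2,2)-freeness forces b to have no left-neighbour and w no right-neighbour,
-- and we swap b and w.  Either swap keeps every vertex other than c paved and brings b
-- immediately before c, and then swapping b and c paves c as well.  Finally, swapping two
-- consecutive vertices joined by a backedge keeps every vertex paved and strictly shrinks the
-- set of vertices having a left-neighbour, so it eventually removes all consecutive backedges.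
module Submission where

open import Defs
open import Data.Empty using (⊥; ⊥-elim)
open import Data.Fin using (Fin; toℕ; fromℕ<; opposite; _≟_)
open import Data.Fin.Permutation
  using (_⟨$⟩ʳ_; _⟨$⟩ˡ_; inverseˡ; inverseʳ; transpose; reverse; _∘ₚ_)
import Data.Fin.Permutation.Components as PC
open import Data.Fin.Properties
  using (toℕ-injective; toℕ-fromℕ<; toℕ<n; any?; opposite-prop; opposite-involutive)
open import Data.Fin.Subset using (Subset; _∈_; _⊂_; ∣_∣)
open import Data.Fin.Subset.Properties using (p⊂q⇒∣p∣<∣q∣)
open import Data.Nat using (ℕ; suc; _<_; _≤_; _<?_; s≤s; s≤s⁻¹)
open import Data.Nat.Induction using (<-wellFounded)
open import Data.Nat.Properties
  using (<-irrefl; <-asym; <-trans; ≤-<-trans; <-cmp; ≤∧≢⇒<; m≤n⇒m<n∨m≡n; n<1+n; ∸-monoʳ-<)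
  renaming (_≟_ to _≟ℕ_)
open import Data.Product using (∃; ∃₂; _×_; _,_; proj₁; proj₂)
import Data.Product as Product
open import Data.Sum using (_⊎_; inj₁; inj₂; [_,_])
import Data.Sum as Sum
open import Data.Vec using (tabulate)
open import Data.Vec.Properties using (lookup∘tabulate; lookup⇒[]=; []=⇒lookup)
open import Function using (_∘_)
open import Function.Bundles using (_⇔_; mk⇔; Equivalence)
open import Induction.WellFounded using (Acc; acc)
open import Level using (0ℓ)
open import Relation.Binary.Definitions using (tri<; tri≈; tri>)
open import Relation.Binary.PropositionalEquality
  using (_≡_; _≢_; refl; sym; trans; cong; subst; subst₂)
open import Relation.Nullary using (Dec; yes; no; ¬_; does)
open import Relation.Nullary.Decidable using (_×-dec_; dec-true; dec-false)
open import Relation.Unary using (Pred; Decidable; _⊆_; _∪_; ｛_｝)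

private variable n : ℕ

Subsingleton : {A : Set} → Pred A 0ℓ → Set
Subsingleton P = ∀ {x y} → P x → P y → x ≡ y

subsingleton-anti : {A : Set} {P Q : Pred A 0ℓ} → P ⊆ Q → Subsingleton Q → Subsingleton P
subsingleton-anti P⊆Q Q! p p′ = Q! (P⊆Q p) (P⊆Q p′)

subsingleton-｛｝ : {A : Set} {t : A} → Subsingleton ｛ t ｝
subsingleton-｛｝ t≡x t≡y = trans (sym t≡x) t≡y

IsPair : {A : Set} → Pred A 0ℓ → A → A → Set
IsPair P a b = a ≢ b × P a × P b × P ⊆ ｛ a ｝ ∪ ｛ b ｝

isPair-cong : {A : Set} {P Q : Pred A 0ℓ} {a b : A} →
              P ⊆ Q → Q ⊆ P → IsPair P a b → IsPair Q a b
isPair-cong P⊆Q Q⊆P (a≢b , Pa , Pb , P⊆ab) = a≢b , P⊆Q Pa , P⊆Q Pb , P⊆ab ∘ Q⊆P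

fromDec : {P : Pred (Fin n) 0ℓ} → Decidable P → Subset n
fromDec P? = tabulate (does ∘ P?)

module _ {P : Pred (Fin n) 0ℓ} (P? : Decidable P) where

  ∈-fromDec⁺ : ∀ {x} → P x → x ∈ fromDec P?
  ∈-fromDec⁺ {x} px = lookup⇒[]= x _ (trans (lookup∘tabulate _ x) (dec-true (P? x) px))

  ∈-fromDec⁻ : ∀ {x} → x ∈ fromDec P? → P x
  ∈-fromDec⁻ {x} x∈
    with P? x | trans (sym (lookup∘tabulate (does ∘ P?) x)) ([]=⇒lookup x∈)
  ... | yes px | _ = px
  ... | no _   | ()

pos : Ordering n → Fin n → ℕ
pos σ u = toℕ (σ ⟨$⟩ˡ u)

module _ (σ : Ordering n) where

  pos-⟨$⟩ʳ : ∀ i → pos σ (σ ⟨$⟩ʳ i) ≡ toℕ i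
  pos-⟨$⟩ʳ i = cong toℕ (inverseˡ σ)

  ⟨$⟩ʳ-injective : ∀ {i j} → σ ⟨$⟩ʳ i ≡ σ ⟨$⟩ʳ j → i ≡ j
  ⟨$⟩ʳ-injective {i} {j} e = trans (sym (inverseˡ σ)) (trans (cong (σ ⟨$⟩ˡ_) e) (inverseˡ σ))

  ⟨$⟩ˡ-injective : ∀ {u z} → σ ⟨$⟩ˡ u ≡ σ ⟨$⟩ˡ z → u ≡ z
  ⟨$⟩ˡ-injective e = trans (sym (inverseʳ σ)) (trans (cong (σ ⟨$⟩ʳ_) e) (inverseʳ σ))

  pos-injective : ∀ {u z} → pos σ u ≡ pos σ z → u ≡ z
  pos-injective = ⟨$⟩ˡ-injective ∘ toℕ-injective

  vertexAt : ∀ k → k < n → ∃ λ u → pos σ u ≡ k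
  vertexAt k k<n = σ ⟨$⟩ʳ fromℕ< k<n , trans (pos-⟨$⟩ʳ _) (toℕ-fromℕ< k<n)

<-pos⇒≢ : {σ : Ordering n} {u z : Fin n} → pos σ u < pos σ z → u ≢ z
<-pos⇒≢ lt refl = <-irrefl refl lt

transpose-i : (i j : Fin n) → PC.transpose i j i ≡ j
transpose-i i j rewrite dec-true (i ≟ i) refl = refl

transpose-j : (i j : Fin n) → i ≢ j → PC.transpose i j j ≡ i
transpose-j i j i≢j rewrite dec-false (j ≟ i) (i≢j ∘ sym) | dec-true (j ≟ j) refl = refl

transpose-k : (i j k : Fin n) → k ≢ i → k ≢ j → PC.transpose i j k ≡ k
transpose-k i j k k≢i k≢j rewrite dec-false (k ≟ i) k≢i | dec-false (k ≟ j) k≢j = refl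

record AdjacentSwap (σ σ′ : Ordering n) (x y : Fin n) : Set where
  field
    adjacent  : pos σ y ≡ suc (pos σ x)
    pos-x     : pos σ′ x ≡ pos σ y
    pos-y     : pos σ′ y ≡ pos σ x
    pos-other : ∀ {u} → u ≢ x → u ≢ y → pos σ′ u ≡ pos σ u

  x<y : pos σ x < pos σ y
  x<y = subst (pos σ x <_) (sym adjacent) (n<1+n _)

adjacentSwap : (σ : Ordering n) {x y : Fin n} → pos σ y ≡ suc (pos σ x) →
               ∃ λ σ′ → AdjacentSwap σ σ′ x y
adjacentSwap σ {x} {y} adj = transpose kx ky ∘ₚ σ , record
  { adjacent  = adj
  ; pos-x     = cong toℕ (transpose-j ky kx ky≢kx)
  ; pos-y     = cong toℕ (transpose-i ky kx)
  ; pos-other = λ {u} u≢x u≢y →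
      cong toℕ (transpose-k ky kx (σ ⟨$⟩ˡ u)
                              (u≢y ∘ ⟨$⟩ˡ-injective σ) (u≢x ∘ ⟨$⟩ˡ-injective σ))
  }
  where
  kx ky : Fin _
  kx = σ ⟨$⟩ˡ x
  ky = σ ⟨$⟩ˡ y
  ky≢kx : ky ≢ kx
  ky≢kx e = <-irrefl (cong toℕ (sym e)) (subst (pos σ x <_) (sym adj) (n<1+n _))

adjacentSwap-sym : {σ σ′ : Ordering n} {x y : Fin n} →
                   AdjacentSwap σ σ′ x y → AdjacentSwap σ′ σ y x
adjacentSwap-sym s = record
  { adjacent  = trans pos-x (trans adjacent (cong suc (sym pos-y)))
  ; pos-x     = sym pos-x
  ; pos-y     = sym pos-y
  ; pos-other = λ u≢y u≢x → sym (pos-other u≢x u≢y)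
  }
  where open AdjacentSwap s

module _ {σ σ′ : Ordering n} {x y : Fin n} (s : AdjacentSwap σ σ′ x y) where
  open AdjacentSwap s

  private
    classify : ∀ u → u ≡ x ⊎ u ≡ y ⊎ (u ≢ x × u ≢ y)
    classify u with u ≟ x | u ≟ y
    ... | yes u≡x | _       = inj₁ u≡x
    ... | no _    | yes u≡y = inj₂ (inj₁ u≡y)
    ... | no u≢x  | no u≢y  = inj₂ (inj₂ (u≢x , u≢y))

  swap-< : ∀ {u z} → pos σ′ u < pos σ′ z → pos σ u < pos σ z ⊎ (u ≡ y × z ≡ x)
  swap-< {u} {z} lt with classify u | classify z
  ... | inj₁ refl        | inj₁ refl        = ⊥-elim (<-irrefl refl lt)
  ... | inj₁ refl        | inj₂ (inj₁ refl) =
    ⊥-elim (<-asym x<y (subst₂ _<_ pos-x pos-y lt))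
  ... | inj₁ refl        | inj₂ (inj₂ (z≢x , z≢y)) =
    inj₁ (<-trans x<y (subst₂ _<_ pos-x (pos-other z≢x z≢y) lt))
  ... | inj₂ (inj₁ refl) | inj₁ refl        = inj₂ (refl , refl)
  ... | inj₂ (inj₁ refl) | inj₂ (inj₁ refl) = ⊥-elim (<-irrefl refl lt)
  ... | inj₂ (inj₁ refl) | inj₂ (inj₂ (z≢x , z≢y)) =
    inj₁ (≤∧≢⇒< (subst (_≤ pos σ z) (sym adjacent)
                        (subst₂ _<_ pos-y (pos-other z≢x z≢y) lt))
                (z≢y ∘ pos-injective σ ∘ sym))
  ... | inj₂ (inj₂ (u≢x , u≢y)) | inj₁ refl =
    inj₁ (≤∧≢⇒< (s≤s⁻¹ (subst (pos σ u <_) adjacent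
                               (subst₂ _<_ (pos-other u≢x u≢y) pos-x lt)))
                (u≢x ∘ pos-injective σ))
  ... | inj₂ (inj₂ (u≢x , u≢y)) | inj₂ (inj₁ refl) =
    inj₁ (<-trans (subst₂ _<_ (pos-other u≢x u≢y) pos-y lt) x<y)
  ... | inj₂ (inj₂ (u≢x , u≢y)) | inj₂ (inj₂ (z≢x , z≢y)) =
    inj₁ (subst₂ _<_ (pos-other u≢x u≢y) (pos-other z≢x z≢y) lt)

opposite-< : {i j : Fin n} → toℕ i < toℕ j → toℕ (opposite j) < toℕ (opposite i)
opposite-< {i = i} {j} i<j rewrite opposite-prop i | opposite-prop j =
  ∸-monoʳ-< (s≤s i<j) (toℕ<n j)

module _ {σ : Ordering n} {u z : Fin n} where

  pos-reverse-<⁺ : pos σ z < pos σ u → pos (reverse ∘ₚ σ) u < pos (reverse ∘ₚ σ) z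
  pos-reverse-<⁺ = opposite-<

  pos-reverse-<⁻ : pos (reverse ∘ₚ σ) u < pos (reverse ∘ₚ σ) z → pos σ z < pos σ u
  pos-reverse-<⁻ lt =
    subst₂ (λ i j → toℕ i < toℕ j) (opposite-involutive _) (opposite-involutive _) (opposite-< lt)

module _ (T : Tournament n) where

  infix 4 _⟶_
  _⟶_ : Fin n → Fin n → Set
  u ⟶ z = _⇒_ T u z

  Left : Ordering n → Fin n → Pred (Fin n) 0ℓ
  Left σ u z = pos σ z < pos σ u × u ⟶ z

  Right : Ordering n → Fin n → Pred (Fin n) 0ℓ
  Right σ u z = Left σ z u

  left? : ∀ σ u → Decidable (Left σ u)
  left? σ u z = (pos σ z <? pos σ u) ×-dec ⇒-dec T u z

  PavedVertex : Ordering n → Fin n → Set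
  PavedVertex σ u = Subsingleton (Left σ u) × Subsingleton (Right σ u)

  AllPaved : Ordering n → Set
  AllPaved σ = ∀ u → PavedVertex σ u

  ⟶-later : ∀ {σ u z} → pos σ u < pos σ z → ¬ Left σ z u → u ⟶ z
  ⟶-later {σ} {u} {z} u<z z↛u with total T u z (<-pos⇒≢ {σ = σ} u<z)
  ... | inj₁ u⇒z = u⇒z
  ... | inj₂ z⇒u = ⊥-elim (z↛u (u<z , z⇒u))

  ⟶-later-except : ∀ {σ u t z} → Subsingleton (Right σ u) → Right σ u t →
                   pos σ u < pos σ z → z ≢ t → u ⟶ z
  ⟶-later-except {σ} right! rt u<z z≢t = ⟶-later {σ} u<z (λ rz → z≢t (right! rz rt))

  swap-left : ∀ {σ σ′ x y u} → AdjacentSwap σ σ′ x y →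
              Left σ′ u ⊆ Left σ u ∪ (λ z → u ≡ x × z ≡ y)
  swap-left s (z<u , u⇒z) = Sum.map (_, u⇒z) Product.swap (swap-< s z<u)

  module BackwardSwap {σ σ′ x y} (s : AdjacentSwap σ σ′ x y) (y⇒x : y ⟶ x) where

    left⊆ : ∀ {u} → Left σ′ u ⊆ Left σ u
    left⊆ l with swap-left s l
    ... | inj₁ l′          = l′
    ... | inj₂ (refl , refl) = ⊥-elim (asym T _ _ y⇒x (proj₂ l))

    right⊆ : ∀ {u} → Right σ′ u ⊆ Right σ u
    right⊆ = left⊆

    pavedVertex : ∀ {u} → PavedVertex σ u → PavedVertex σ′ u
    pavedVertex = Product.map (subsingleton-anti left⊆) (subsingleton-anti right⊆)

    x-not-left-of-y : ¬ Left σ′ y x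
    x-not-left-of-y (lt , _) = <-asym x<y (subst₂ _<_ pos-x pos-y lt)
      where open AdjacentSwap s

  module ForwardSwap {σ σ′ x y} (s : AdjacentSwap σ σ′ x y) (x⇒y : x ⟶ y)
    (x-no-left : ∀ z → ¬ Left σ x z) (y-no-right : ∀ z → ¬ Right σ y z) where

    left⊇ : ∀ {u} → Left σ u ⊆ Left σ′ u
    left⊇ = BackwardSwap.left⊆ (adjacentSwap-sym s) x⇒y

    left-subsingleton : ∀ {u} → Subsingleton (Left σ u) → Subsingleton (Left σ′ u)
    left-subsingleton {u} left! with u ≟ x
    ... | yes refl = subsingleton-anti only-y subsingleton-｛｝
      where
      only-y : Left σ′ x ⊆ ｛ y ｝
      only-y l with swap-left s l
      ... | inj₁ l′       = ⊥-elim (x-no-left _ l′)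
      ... | inj₂ (_ , z≡y) = sym z≡y
    ... | no u≢x = subsingleton-anti old left!
      where
      old : Left σ′ u ⊆ Left σ u
      old l with swap-left s l
      ... | inj₁ l′        = l′
      ... | inj₂ (u≡x , _) = ⊥-elim (u≢x u≡x)

    right-subsingleton : ∀ {u} → Subsingleton (Right σ u) → Subsingleton (Right σ′ u)
    right-subsingleton {u} right! with u ≟ y
    ... | yes refl = subsingleton-anti only-x subsingleton-｛｝
      where
      only-x : Right σ′ y ⊆ ｛ x ｝
      only-x r with swap-left s r
      ... | inj₁ r′       = ⊥-elim (y-no-right _ r′)
      ... | inj₂ (z≡x , _) = sym z≡x
    ... | no u≢y = subsingleton-anti old right!
      where
      old : Right σ′ u ⊆ Right σ u
      old r with swap-left s r
      ... | inj₁ r′        = r′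
      ... | inj₂ (_ , u≡y) = ⊥-elim (u≢y u≡y)

    pavedVertex : ∀ {u} → PavedVertex σ u → PavedVertex σ′ u
    pavedVertex = Product.map left-subsingleton right-subsingleton

  module _ (σ : Ordering n) where

    leftNbr⇔ : ∀ i j → LeftNbr T σ i j ⇔ Left σ (σ ⟨$⟩ʳ i) (σ ⟨$⟩ʳ j)
    leftNbr⇔ i j = mk⇔ to from
      where
      to : LeftNbr T σ i j → Left σ (σ ⟨$⟩ʳ i) (σ ⟨$⟩ʳ j)
      to (j<i , inj₁ (_ , i⇒j))  =
        subst₂ _<_ (sym (pos-⟨$⟩ʳ σ j)) (sym (pos-⟨$⟩ʳ σ i)) j<i , i⇒j
      to (j<i , inj₂ (i<j , _)) = ⊥-elim (<-asym j<i i<j)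
      from : Left σ (σ ⟨$⟩ʳ i) (σ ⟨$⟩ʳ j) → LeftNbr T σ i j
      from (lt , i⇒j) = j<i , inj₁ (j<i , i⇒j)
        where j<i = subst₂ _<_ (pos-⟨$⟩ʳ σ j) (pos-⟨$⟩ʳ σ i) lt

    rightNbr⇔ : ∀ i j → RightNbr T σ i j ⇔ Right σ (σ ⟨$⟩ʳ i) (σ ⟨$⟩ʳ j)
    rightNbr⇔ i j = mk⇔ to from
      where
      to : RightNbr T σ i j → Right σ (σ ⟨$⟩ʳ i) (σ ⟨$⟩ʳ j)
      to (i<j , inj₂ (_ , j⇒i))  =
        subst₂ _<_ (sym (pos-⟨$⟩ʳ σ i)) (sym (pos-⟨$⟩ʳ σ j)) i<j , j⇒i
      to (i<j , inj₁ (j<i , _)) = ⊥-elim (<-asym j<i i<j)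
      from : Right σ (σ ⟨$⟩ʳ i) (σ ⟨$⟩ʳ j) → RightNbr T σ i j
      from (lt , j⇒i) = i<j , inj₂ (i<j , j⇒i)
        where i<j = subst₂ _<_ (pos-⟨$⟩ʳ σ i) (pos-⟨$⟩ʳ σ j) lt

    module Transport {P Q : Pred (Fin n) 0ℓ} (P⇔Q : ∀ j → P j ⇔ Q (σ ⟨$⟩ʳ j)) where

      private
        P⇒Q : ∀ {j} → P j → Q (σ ⟨$⟩ʳ j)
        P⇒Q = Equivalence.to (P⇔Q _)

        Q⇒P : ∀ {z} → Q z → P (σ ⟨$⟩ˡ z)
        Q⇒P q = Equivalence.from (P⇔Q _) (subst Q (sym (inverseʳ σ)) q)

      subsingleton⁺ : AtMostOne T σ P → Subsingleton Q
      subsingleton⁺ P! q q′ = ⟨$⟩ˡ-injective σ (P! _ _ (Q⇒P q) (Q⇒P q′))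

      subsingleton⁻ : Subsingleton Q → AtMostOne T σ P
      subsingleton⁻ Q! _ _ p p′ = ⟨$⟩ʳ-injective σ (Q! (P⇒Q p) (P⇒Q p′))

      exactlyTwo⁺ : ExactlyTwo T σ P → ∃₂ (IsPair Q)
      exactlyTwo⁺ (j , k , j≢k , pj , pk , only) =
        σ ⟨$⟩ʳ j , σ ⟨$⟩ʳ k , j≢k ∘ ⟨$⟩ʳ-injective σ , P⇒Q pj , P⇒Q pk ,
        Sum.map at at ∘ only _ ∘ Q⇒P
        where
        at : ∀ {l z} → σ ⟨$⟩ˡ z ≡ l → σ ⟨$⟩ʳ l ≡ z
        at refl = inverseʳ σ

    paved⇒ : ∀ {i} → Paved T σ i → PavedVertex σ (σ ⟨$⟩ʳ i)
    paved⇒ {i} = Product.map (Transport.subsingleton⁺ (leftNbr⇔ i))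
                             (Transport.subsingleton⁺ (rightNbr⇔ i))

    paved⇐ : ∀ {i} → PavedVertex σ (σ ⟨$⟩ʳ i) → Paved T σ i
    paved⇐ {i} = Product.map (Transport.subsingleton⁻ (leftNbr⇔ i))
                             (Transport.subsingleton⁻ (rightNbr⇔ i))

  NearlyPavedVertex : Ordering n → Fin n → Set
  NearlyPavedVertex σ c = (∃₂ (IsPair (Left σ c)) × Subsingleton (Right σ c))
                        ⊎ (Subsingleton (Left σ c) × ∃₂ (IsPair (Right σ c)))

  module _ (σ : Ordering n) where

    nearlyPaved⇒ : ∀ {i} → NearlyPaved T σ i → NearlyPavedVertex σ (σ ⟨$⟩ʳ i)
    nearlyPaved⇒ {i} = Sum.map
      (Product.map (Transport.exactlyTwo⁺ σ (leftNbr⇔ σ i))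
                   (Transport.subsingleton⁺ σ (rightNbr⇔ σ i)))
      (Product.map (Transport.subsingleton⁺ σ (leftNbr⇔ σ i))
                   (Transport.exactlyTwo⁺ σ (rightNbr⇔ σ i)))

    othersPaved⇒ : ∀ {i} → (∀ j → j ≢ i → Paved T σ j) →
                   ∀ {u} → u ≢ σ ⟨$⟩ʳ i → PavedVertex σ u
    othersPaved⇒ others {u} u≢c = subst (PavedVertex σ) (inverseʳ σ)
      (paved⇒ σ (others _ (λ e → u≢c (trans (sym (inverseʳ σ)) (cong (σ ⟨$⟩ʳ_) e)))))

  ConsecutiveBackedge : Ordering n → Set
  ConsecutiveBackedge σ = ∃₂ λ x y → pos σ y ≡ suc (pos σ x) × y ⟶ x

  consecutiveBackedge? : ∀ σ → Dec (ConsecutiveBackedge σ)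
  consecutiveBackedge? σ =
    any? λ x → any? λ y → (pos σ y ≟ℕ suc (pos σ x)) ×-dec ⇒-dec T y x

  consecutiveNonadjacent : ∀ σ → ¬ ConsecutiveBackedge σ → ConsecutiveNonadjacent T σ
  consecutiveNonadjacent σ none i i+1<n (inj₁ (j<i , _)) =
    <-asym (n<1+n (toℕ i)) (subst (_< toℕ i) (toℕ-fromℕ< i+1<n) j<i)
  consecutiveNonadjacent σ none i i+1<n (inj₂ (_ , j⇒i)) =
    none (σ ⟨$⟩ʳ i , σ ⟨$⟩ʳ j , adjacent , j⇒i)
    where
    j = fromℕ< i+1<n
    adjacent : pos σ (σ ⟨$⟩ʳ j) ≡ suc (pos σ (σ ⟨$⟩ʳ i))
    adjacent =
      trans (pos-⟨$⟩ʳ σ j) (trans (toℕ-fromℕ< i+1<n) (cong suc (sym (pos-⟨$⟩ʳ σ i))))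

  -- The termination measure: in a paved ordering y has x as its only left-neighbour, so
  -- swapping a consecutive backedge y → x leaves y without left-neighbours.
  withLeftNbr : Ordering n → Subset n
  withLeftNbr σ = fromDec (λ u → any? (left? σ u))

  backwardSwap-⊂ : ∀ {σ σ′ x y} → AdjacentSwap σ σ′ x y → y ⟶ x → AllPaved σ →
                   withLeftNbr σ′ ⊂ withLeftNbr σ
  backwardSwap-⊂ {σ} {σ′} {x} {y} s y⇒x paved =
    ∈⁺ σ ∘ Product.map₂ left⊆ ∘ ∈⁻ σ′ , y , ∈⁺ σ (x , x-left-of-y) , y∉
    where
    open BackwardSwap s y⇒x
    ∈⁺ : ∀ σ {u} → ∃ (Left σ u) → u ∈ withLeftNbr σ
    ∈⁺ σ = ∈-fromDec⁺ (λ u → any? (left? σ u))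
    ∈⁻ : ∀ σ {u} → u ∈ withLeftNbr σ → ∃ (Left σ u)
    ∈⁻ σ = ∈-fromDec⁻ (λ u → any? (left? σ u))
    x-left-of-y : Left σ y x
    x-left-of-y = AdjacentSwap.x<y s , y⇒x
    y∉ : ¬ y ∈ withLeftNbr σ′
    y∉ y∈ with ∈⁻ σ′ y∈
    ... | _ , l = x-not-left-of-y (subst (Left σ′ y) (proj₁ (paved y) (left⊆ l) x-left-of-y) l)

  allPaved⇒paving : ∀ σ → AllPaved σ → Paving T
  allPaved⇒paving σ₀ = go σ₀ (<-wellFounded _)
    where
    go : ∀ σ → Acc _<_ ∣ withLeftNbr σ ∣ → AllPaved σ → Paving T
    go σ (acc smaller) paved with consecutiveBackedge? σ
    ... | no none = σ , consecutiveNonadjacent σ none , λ i → paved⇐ σ (paved (σ ⟨$⟩ʳ i))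
    ... | yes (x , y , adjacent , y⇒x) with adjacentSwap σ adjacent
    ...   | σ′ , s = go σ′ (smaller (p⊂q⇒∣p∣<∣q∣ (backwardSwap-⊂ s y⇒x paved)))
                           (BackwardSwap.pavedVertex s y⇒x ∘ paved)

  record LeftNearlyPaved (σ : Ordering n) (c a b : Fin n) : Set where
    field
      left-pair          : IsPair (Left σ c) a b
      right-subsingleton : Subsingleton (Right σ c)
      others-paved       : ∀ {u} → u ≢ c → PavedVertex σ u

    a≢b : a ≢ b
    a≢b = proj₁ left-pair

    left-a : Left σ c a
    left-a = proj₁ (proj₂ left-pair)

    left-b : Left σ c b
    left-b = proj₁ (proj₂ (proj₂ left-pair))

    left-only : Left σ c ⊆ ｛ a ｝ ∪ ｛ b ｝
    left-only = proj₂ (proj₂ (proj₂ left-pair))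

  leftNearlyPaved-sym : ∀ {σ c a b} → LeftNearlyPaved σ c a b → LeftNearlyPaved σ c b a
  leftNearlyPaved-sym cfg = record
    { left-pair          = a≢b ∘ sym , left-b , left-a , Sum.swap ∘ left-only
    ; right-subsingleton = right-subsingleton
    ; others-paved       = others-paved
    }
    where open LeftNearlyPaved cfg

  forwardSwap-leftNearlyPaved :
    ∀ {σ σ′ x y c a b} (s : AdjacentSwap σ σ′ x y) (x⇒y : x ⟶ y)
    (x-no-left : ∀ z → ¬ Left σ x z) (y-no-right : ∀ z → ¬ Right σ y z) →
    LeftNearlyPaved σ c a b → c ≢ x → LeftNearlyPaved σ′ c a b
  forwardSwap-leftNearlyPaved {σ} {σ′} {c = c} s x⇒y x-no-left y-no-right cfg c≢x = record
    { left-pair          = a≢b , left⊇ left-a , left⊇ left-b , left-only ∘ left⊆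
    ; right-subsingleton = Swap.right-subsingleton right-subsingleton
    ; others-paved       = Swap.pavedVertex ∘ others-paved
    }
    where
    open LeftNearlyPaved cfg
    module Swap = ForwardSwap s x⇒y x-no-left y-no-right
    open Swap using (left⊇)
    left⊆ : Left σ′ c ⊆ Left σ c
    left⊆ l with swap-left s l
    ... | inj₁ l′        = l′
    ... | inj₂ (c≡x , _) = ⊥-elim (c≢x c≡x)

  adjacent-allPaved : ∀ {σ c a b} → LeftNearlyPaved σ c a b → pos σ c ≡ suc (pos σ b) →
                      ∃ AllPaved
  adjacent-allPaved {σ} {c} {a} cfg b⋖c with adjacentSwap σ b⋖c
  ... | σ′ , s = σ′ , paved
    where
    open LeftNearlyPaved cfg
    open BackwardSwap s (proj₂ left-b)
    only-a : Left σ′ c ⊆ ｛ a ｝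
    only-a l with left-only (left⊆ l)
    ... | inj₁ a≡z  = a≡z
    ... | inj₂ refl = ⊥-elim (x-not-left-of-y l)
    paved : AllPaved σ′
    paved u with u ≟ c
    ... | yes refl =
      subsingleton-anti only-a subsingleton-｛｝ , subsingleton-anti right⊆ right-subsingleton
    ... | no u≢c   = pavedVertex (others-paved u≢c)

  module _ (free : Δ122-free T) where

    no-Δ122 : ∀ {x y₁ y₂ z₁ z₂} → y₁ ≢ y₂ → z₁ ≢ z₂ → x ⟶ y₁ → x ⟶ y₂ →
              y₁ ⟶ z₁ → y₁ ⟶ z₂ → y₂ ⟶ z₁ → y₂ ⟶ z₂ → z₁ ⟶ x → z₂ ⟶ x → ⊥
    no-Δ122 {x} {y₁} {y₂} {z₁} {z₂}
            y₁≢y₂ z₁≢z₂ x⇒y₁ x⇒y₂ y₁⇒z₁ y₁⇒z₂ y₂⇒z₁ y₂⇒z₂ z₁⇒x z₂⇒x =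
      free (record
        { x = x ; y₁ = y₁ ; y₂ = y₂ ; z₁ = z₁ ; z₂ = z₂ ; y₁≢y₂ = y₁≢y₂ ; z₁≢z₂ = z₁≢z₂
        ; x⇒y₁ = x⇒y₁ ; x⇒y₂ = x⇒y₂ ; y₁⇒z₁ = y₁⇒z₁ ; y₁⇒z₂ = y₁⇒z₂ ; y₂⇒z₁ = y₂⇒z₁
        ; y₂⇒z₂ = y₂⇒z₂ ; z₁⇒x = z₁⇒x ; z₂⇒x = z₂⇒x })

    module Sorted {σ c a b} (cfg : LeftNearlyPaved σ c a b) (a≺b : pos σ a < pos σ b) where
      open LeftNearlyPaved cfg

      private
        infix 4 _≺_
        _≺_ : Fin n → Fin n → Set
        u ≺ z = pos σ u < pos σ z

        ≺⇒≢ : ∀ {u z} → u ≺ z → u ≢ z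
        ≺⇒≢ = <-pos⇒≢ {σ = σ}

      b≺c : b ≺ c
      b≺c = proj₁ left-b

      c⟶a : c ⟶ a
      c⟶a = proj₂ left-a

      c⟶b : c ⟶ b
      c⟶b = proj₂ left-b

      earlier⟶c : ∀ {z} → z ≺ c → z ≢ a → z ≢ b → z ⟶ c
      earlier⟶c z≺c z≢a z≢b = ⟶-later {σ} z≺c ([ z≢a ∘ sym , z≢b ∘ sym ] ∘ left-only)

      a⟶later : ∀ {z} → a ≺ z → z ≢ c → a ⟶ z
      a⟶later = ⟶-later-except {σ} (proj₂ (others-paved (≺⇒≢ (proj₁ left-a)))) left-a

      b⟶later : ∀ {z} → b ≺ z → z ≢ c → b ⟶ z
      b⟶later = ⟶-later-except {σ} (proj₂ (others-paved (≺⇒≢ b≺c))) left-b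

      Closing : Pred (Fin n) 0ℓ
      Closing z = b ≺ z × z ≢ c × z ⟶ c

      closing-unique : Subsingleton Closing
      closing-unique {z} {z′} (b≺z , z≢c , z⟶c) (b≺z′ , z′≢c , z′⟶c) with z ≟ z′
      ... | yes z≡z′ = z≡z′
      ... | no z≢z′  = ⊥-elim (no-Δ122 a≢b z≢z′ c⟶a c⟶b
                         (a⟶later (<-trans a≺b b≺z) z≢c) (a⟶later (<-trans a≺b b≺z′) z′≢c)
                         (b⟶later b≺z z≢c) (b⟶later b≺z′ z′≢c) z⟶c z′⟶c)

      between-closing : ∀ {z} → b ≺ z → z ≺ c → Closing z
      between-closing b≺z z≺c =
        b≺z , ≺⇒≢ z≺c , earlier⟶c z≺c (≺⇒≢ (<-trans a≺b b≺z) ∘ sym) (≺⇒≢ b≺z ∘ sym)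

      ⋖⇒≺ : ∀ {u z} → pos σ z ≡ suc (pos σ u) → u ≺ z
      ⋖⇒≺ {u} u⋖z = subst (pos σ u <_) (sym u⋖z) (n<1+n _)

      successor : ∀ {u} → u ≺ c → ∃ λ z → pos σ z ≡ suc (pos σ u)
      successor u≺c = vertexAt σ _ (≤-<-trans u≺c (toℕ<n (σ ⟨$⟩ˡ c)))

      gap : pos σ c ≡ suc (pos σ b) ⊎ ∃ λ w → pos σ w ≡ suc (pos σ b) × pos σ c ≡ suc (pos σ w)
      gap with m≤n⇒m<n∨m≡n b≺c
      ... | inj₂ b⋖c   = inj₁ (sym b⋖c)
      ... | inj₁ b+1≺c = inj₂ (w , b⋖w , w⋖c)
        where
        w = proj₁ (successor b≺c)
        b⋖w = proj₂ (successor b≺c)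
        w≺c : w ≺ c
        w≺c = subst (_< pos σ c) (sym b⋖w) b+1≺c
        w⋖c : pos σ c ≡ suc (pos σ w)
        w⋖c with m≤n⇒m<n∨m≡n w≺c
        ... | inj₂ w⋖c   = sym w⋖c
        ... | inj₁ w+1≺c = ⊥-elim (≺⇒≢ (⋖⇒≺ w⋖w′)
                (closing-unique (between-closing (⋖⇒≺ b⋖w) w≺c)
                                (between-closing (<-trans (⋖⇒≺ b⋖w) (⋖⇒≺ w⋖w′)) w′≺c)))
          where
          w′ = proj₁ (successor w≺c)
          w⋖w′ = proj₂ (successor w≺c)
          w′≺c : w′ ≺ c
          w′≺c = subst (_< pos σ c) (sym w⋖w′) w+1≺c

      module Gap {w} (b⋖w : pos σ w ≡ suc (pos σ b)) (w⋖c : pos σ c ≡ suc (pos σ w)) where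

        b≺w : b ≺ w
        b≺w = ⋖⇒≺ b⋖w

        w≺c : w ≺ c
        w≺c = ⋖⇒≺ w⋖c

        w-closing : Closing w
        w-closing = between-closing b≺w w≺c

        w⟶c : w ⟶ c
        w⟶c = proj₂ (proj₂ w-closing)

        a⟶w : a ⟶ w
        a⟶w = a⟶later (<-trans a≺b b≺w) (≺⇒≢ w≺c)

        b⟶w : b ⟶ w
        b⟶w = b⟶later b≺w (≺⇒≢ w≺c)

        c-no-right : ∀ z → ¬ Right σ c z
        c-no-right z (c≺z , z⟶c) = ≺⇒≢ (<-trans w≺c c≺z)
          (closing-unique w-closing (<-trans b≺c c≺z , ≺⇒≢ c≺z ∘ sym , z⟶c))

        module LeftNbrOfW {p} (left-p : Left σ w p) where

          p≺w : p ≺ w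
          p≺w = proj₁ left-p

          w⟶p : w ⟶ p
          w⟶p = proj₂ left-p

          p≢a : p ≢ a
          p≢a refl = asym T _ _ a⟶w w⟶p

          p≢b : p ≢ b
          p≢b refl = asym T _ _ b⟶w w⟶p

          p≢c : p ≢ c
          p≢c = ≺⇒≢ (<-trans p≺w w≺c)

          p≺b : p ≺ b
          p≺b = ≤∧≢⇒< (s≤s⁻¹ (subst (pos σ p <_) b⋖w p≺w)) (p≢b ∘ pos-injective σ)

          p⟶later : ∀ {z} → p ≺ z → z ≢ w → p ⟶ z
          p⟶later = ⟶-later-except {σ} (proj₂ (others-paved p≢c)) left-p

          p⟶b : p ⟶ b
          p⟶b = p⟶later p≺b (≺⇒≢ b≺w)

          a≺p : a ≺ p
          a≺p with <-cmp (pos σ a) (pos σ p)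
          ... | tri< a≺p _ _ = a≺p
          ... | tri≈ _ a≡p _ = ⊥-elim (p≢a (pos-injective σ (sym a≡p)))
          ... | tri> _ _ p≺a = ⊥-elim (no-Δ122 p≢c (a≢b ∘ sym) w⟶p w⟶c
                                 p⟶b (p⟶later p≺a (≺⇒≢ (<-trans a≺b b≺w))) c⟶b c⟶a b⟶w a⟶w)

          module LeftNbrOfB {q} (left-q : Left σ b q) where

            q≺b : q ≺ b
            q≺b = proj₁ left-q

            b⟶q : b ⟶ q
            b⟶q = proj₂ left-q

            q≢a : q ≢ a
            q≢a refl = ≺⇒≢ b≺c (proj₂ (others-paved (≺⇒≢ (proj₁ left-a))) left-q left-a)

            q≢c : q ≢ c
            q≢c = ≺⇒≢ (<-trans q≺b b≺c)

            q⟶c : q ⟶ c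
            q⟶c = earlier⟶c (<-trans q≺b b≺c) q≢a (≺⇒≢ q≺b)

            absurd : ⊥
            absurd with <-cmp (pos σ q) (pos σ p)
            ... | tri< q≺p _ _ =
              no-Δ122 (≺⇒≢ (<-trans q≺b b≺w)) p≢c b⟶q b⟶w
                (⟶-later-except {σ} (proj₂ (others-paved q≢c)) left-q q≺p p≢b) q⟶c w⟶p w⟶c p⟶b c⟶b
            ... | tri≈ _ q≡p _ = asym T _ _ p⟶b (subst (b ⟶_) (pos-injective σ q≡p) b⟶q)
            ... | tri> _ _ p≺q =
              no-Δ122 a≢b (≺⇒≢ (<-trans q≺b b≺w) ∘ sym) c⟶a c⟶b
                a⟶w (a⟶later (<-trans a≺p p≺q) q≢c) b⟶w b⟶q w⟶c q⟶c

          module RightNbrOfW {s} (right-s : Right σ w s) where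

            w≺s : w ≺ s
            w≺s = proj₁ right-s

            s⟶w : s ⟶ w
            s⟶w = proj₂ right-s

            s≢c : s ≢ c
            s≢c refl = asym T _ _ w⟶c s⟶w

            c≺s : c ≺ s
            c≺s = ≤∧≢⇒< (subst (_≤ pos σ s) (sym w⋖c) w≺s) (s≢c ∘ pos-injective σ ∘ sym)

            absurd : ⊥
            absurd = no-Δ122 p≢c (≺⇒≢ (<-trans b≺w w≺s)) w⟶p w⟶c
              p⟶b (p⟶later (<-trans p≺w w≺s) (≺⇒≢ w≺s ∘ sym))
              c⟶b (⟶-later {σ} c≺s (c-no-right s)) b⟶w s⟶w

        Adjacent : Ordering n → Set
        Adjacent σ′ = LeftNearlyPaved σ′ c a b × pos σ′ c ≡ suc (pos σ′ b)

        swap-b-w : ∀ {p} → Left σ w p → ∃ Adjacent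
        swap-b-w left-p with adjacentSwap σ b⋖w
        ... | σ′ , s = σ′ ,
          forwardSwap-leftNearlyPaved s b⟶w (λ _ → LeftNbrOfB.absurd) (λ _ → RightNbrOfW.absurd) cfg
            (≺⇒≢ b≺c ∘ sym) ,
          trans (pos-other (≺⇒≢ b≺c ∘ sym) (≺⇒≢ w≺c ∘ sym)) (trans w⋖c (cong suc (sym pos-x)))
          where
          open LeftNbrOfW left-p
          open AdjacentSwap s

        swap-w-c : (∀ p → ¬ Left σ w p) → ∃ Adjacent
        swap-w-c w-no-left with adjacentSwap σ w⋖c
        ... | σ′ , s = σ′ ,
          forwardSwap-leftNearlyPaved s w⟶c w-no-left c-no-right cfg (≺⇒≢ w≺c ∘ sym) ,
          trans pos-y (trans b⋖w (cong suc (sym (pos-other (≺⇒≢ b≺w) (≺⇒≢ b≺c)))))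
          where open AdjacentSwap s

        close-gap : ∃ Adjacent
        close-gap with any? (left? σ w)
        ... | yes (_ , left-p) = swap-b-w left-p
        ... | no none          = swap-w-c (λ p left-p → none (p , left-p))

      allPaved : ∃ AllPaved
      allPaved with gap
      ... | inj₁ b⋖c = adjacent-allPaved cfg b⋖c
      ... | inj₂ (w , b⋖w , w⋖c) with Gap.close-gap b⋖w w⋖c
      ...   | σ′ , cfg′ , b⋖′c = adjacent-allPaved cfg′ b⋖′c

    leftNearlyPaved-allPaved : ∀ {σ c a b} → LeftNearlyPaved σ c a b → ∃ AllPaved
    leftNearlyPaved-allPaved {σ} {a = a} {b} cfg with <-cmp (pos σ a) (pos σ b)
    ... | tri< a≺b _ _ = Sorted.allPaved cfg a≺b
    ... | tri≈ _ a≡b _ = ⊥-elim (LeftNearlyPaved.a≢b cfg (pos-injective σ a≡b))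
    ... | tri> _ _ b≺a = Sorted.allPaved (leftNearlyPaved-sym cfg) b≺a

converse : Tournament n → Tournament n
converse T = record
  { _⇒_    = λ u z → _⇒_ T z u
  ; ⇒-dec  = λ u z → ⇒-dec T z u
  ; irrefl = irrefl T
  ; asym   = λ u z → asym T z u
  ; total  = λ u z u≢z → Sum.swap (total T u z u≢z)
  }

Δ122-free-converse : (T : Tournament n) → Δ122-free T → Δ122-free (converse T)
Δ122-free-converse T free d = free (record
  { x = x ; y₁ = z₁ ; y₂ = z₂ ; z₁ = y₁ ; z₂ = y₂ ; y₁≢y₂ = z₁≢z₂ ; z₁≢z₂ = y₁≢y₂
  ; x⇒y₁ = z₁⇒x ; x⇒y₂ = z₂⇒x ; y₁⇒z₁ = y₁⇒z₁ ; y₁⇒z₂ = y₂⇒z₁ ; y₂⇒z₁ = y₁⇒z₂ ; y₂⇒z₂ = y₂⇒z₂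
  ; z₁⇒x = x⇒y₁ ; z₂⇒x = x⇒y₂ })
  where open Δ122 d

module _ (T : Tournament n) (σ : Ordering n) where

  left-converse⇒right : ∀ {u} → Left (converse T) (reverse ∘ₚ σ) u ⊆ Right T σ u
  left-converse⇒right (lt , z⇒u) = pos-reverse-<⁻ {σ = σ} lt , z⇒u

  right⇒left-converse : ∀ {u} → Right T σ u ⊆ Left (converse T) (reverse ∘ₚ σ) u
  right⇒left-converse (lt , z⇒u) = pos-reverse-<⁺ {σ = σ} lt , z⇒u

  pavedVertex-dual : ∀ {u} → PavedVertex T σ u → PavedVertex (converse T) (reverse ∘ₚ σ) u
  pavedVertex-dual (left! , right!) =
    subsingleton-anti left-converse⇒right right! , subsingleton-anti left-converse⇒right left!

allPaved-dual : (T : Tournament n) {σ : Ordering n} →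
                AllPaved (converse T) σ → AllPaved T (reverse ∘ₚ σ)
allPaved-dual T {σ} paved = pavedVertex-dual (converse T) σ ∘ paved

module _ (T : Tournament n) (free : Δ122-free T) {σ : Ordering n} {c : Fin n}
         (others : ∀ {u} → u ≢ c → PavedVertex T σ u) where

  rightNearlyPaved-allPaved : ∀ {a b} → Subsingleton (Left T σ c) → IsPair (Right T σ c) a b →
                              ∃ (AllPaved T)
  rightNearlyPaved-allPaved {a} {b} left! pair =
    let σ′ , paved = leftNearlyPaved-allPaved (converse T) (Δ122-free-converse T free) dual
    in  reverse ∘ₚ σ′ , allPaved-dual T {σ′} paved
    where
    dual : LeftNearlyPaved (converse T) (reverse ∘ₚ σ) c a b
    dual = record
      { left-pair          = isPair-cong (right⇒left-converse T σ) (left-converse⇒right T σ) pair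
      ; right-subsingleton = subsingleton-anti (left-converse⇒right T σ) left!
      ; others-paved       = pavedVertex-dual T σ ∘ others
      }

  nearlyPavedVertex-allPaved : NearlyPavedVertex T σ c → ∃ (AllPaved T)
  nearlyPavedVertex-allPaved (inj₁ ((a , b , pair) , right!)) =
    leftNearlyPaved-allPaved T free {σ} {c} {a} {b}
      (record { left-pair = pair ; right-subsingleton = right! ; others-paved = others })
  nearlyPavedVertex-allPaved (inj₂ (left! , (_ , _ , pair))) =
    rightNearlyPaved-allPaved left! pair

theorem4p6 : {n : ℕ} (T : Tournament n) → Δ122-free T → (σ : Ordering n) →
    (i : Fin n) → NearlyPaved T σ i → (∀ j → j ≢ i → Paved T σ j) →
    Paving T
theorem4p6 T free σ i nearlyPaved others =
  Product.uncurry (allPaved⇒paving T)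
    (nearlyPavedVertex-allPaved T free {σ} (othersPaved⇒ T σ {i} others)
                                       (nearlyPaved⇒ T σ {i} nearlyPaved))
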